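{- Let $G_S$ be an undirected circulant graph on vertices $0,\dots,N-1$ with generating set $S\subset\{1,\dots,\lfloor N/2\rfloor\}$ such that $1\in S$, and bandwidth $M=\max S<N/2$, with symmetric nonnegative edge weights $d_i=A_{j,(i+j)\bmod N}$ ($i=1,\dots,M$; $d_i=0$ if $i\notin S$, $d_1>0$). Let ${\bf L}$ be its graph Laplacian and ${\bf L}_C$ the graph Laplacian of the unweighted simple cycle on $N$ vertices. Then ${\bf L}={\bf P}_{G_S}{\bf L}_C$, where ${\bf P}_{G_S}$ is the symmetric circulant positive definite matrix of bandwidth $M-1$ with entries $P_{G_S}(m,n)=p_{\delta(m,n)}$, $\delta(m,n)=\min(|m-n|,N-|m-n|)$, where \[p_0=\sum_{i=1}^{M}i\,d_i,\qquad p_i=\sum_{k=i+1}^{M}(k-i)\,d_k\ \ (1\le i\le M-1),\qquad p_i=0\ \ (i\ge M);\] equivalently ${\bf P}_{G_S}$ has representer polynomial $P_{G_S}(z)=\big(\sum_{i=1}^M i d_i\big)+\sum_{i=1}^{M-1}\big(\sum_{k=i+1}^M(k-i)d_k\big)(z^i+z^{ -i})$.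
   Context: A circulant graph $G_S$ has an edge between vertices $i$ and $(i\pm s)\bmod N$ for each $s\in S$, of weight $d_s$. Its adjacency matrix ${\bf A}$ is symmetric circulant with $A_{j,(j\pm i)\bmod N}=d_i$, and ${\bf L}=d{\bf I}_N-{\bf A}$ with $d=\sum_{i=1}^M 2d_i$. ${\bf L}_C$ is the circulant matrix with first row $[2\ -1\ 0\ \dots\ 0\ -1]$. The representer polynomial of a symmetric circulant matrix with entries $c_{\delta(m,n)}$ is $c_0+\sum_{i\ge1}c_i(z^i+z^{ -i})$.
   Formalization: The edge weights $d_i$ are rational rather than real, so all matrices have entries in ℚ, and positive definiteness of ${\bf P}_{G_S}$ is tested only on vectors with rational entries. -}

module Defs where

open import Data.Nat as ℕ using (ℕ; zero; suc; _∸_; _⊓_; ∣_-_∣)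
open import Data.Fin using (Fin; toℕ)
import Data.Fin
import Data.Rational
import Relation.Nullary
open import Data.Integer using (+_)
open import Data.Rational using (ℚ; 0ℚ; 1ℚ; _+_; _*_; -_; _-_; _/_)

ℕtoℚ : ℕ → ℚ
ℕtoℚ n = + n / 1

sumUpTo : ℕ → (ℕ → ℚ) → ℚ
sumUpTo zero    f = 0ℚ
sumUpTo (suc n) f = sumUpTo n f + f n

-- Σ_{k=a}^{b} f k   (empty, i.e. 0, when a > b)
sumIcc : ℕ → ℕ → (ℕ → ℚ) → ℚ
sumIcc a b f = sumUpTo (suc b ∸ a) (λ j → f (a ℕ.+ j))

sumFin : (n : ℕ) → (Fin n → ℚ) → ℚ
sumFin zero    f = 0ℚ
sumFin (suc n) f = f Data.Fin.zero + sumFin n (λ i → f (Data.Fin.suc i))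

Mat : ℕ → Set
Mat N = Fin N → Fin N → ℚ

_⊗_ : ∀ {N} → Mat N → Mat N → Mat N
_⊗_ {N} A B m n = sumFin N (λ k → A m k * B k n)

δ : (N : ℕ) → Fin N → Fin N → ℕ
δ N m n = ∣ toℕ m - toℕ n ∣ ⊓ (N ∸ ∣ toℕ m - toℕ n ∣)

symCirc : (N : ℕ) → (ℕ → ℚ) → Mat N
symCirc N c m n = c (δ N m n)

-- adjacency matrix of the circulant graph with weights d_i: A_{j,(j±i) mod N} = d_i
adjacency : (N : ℕ) → (ℕ → ℚ) → Mat N
adjacency N d = symCirc N d

degree : (M : ℕ) → (ℕ → ℚ) → ℚ
degree M d = sumIcc 1 M (λ i → ℕtoℚ 2 * d i)

identity : ∀ {N} → Mat N
identity m n with m Data.Fin.≟ n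
... | Relation.Nullary.yes _ = 1ℚ
... | Relation.Nullary.no _  = 0ℚ

laplacian : (N M : ℕ) → (ℕ → ℚ) → Mat N
laplacian N M d m n = degree M d * identity m n - adjacency N d m n

cycleCoeff : ℕ → ℚ
cycleCoeff 0 = ℕtoℚ 2
cycleCoeff 1 = - 1ℚ
cycleCoeff (suc (suc _)) = 0ℚ

laplacianCycle : (N : ℕ) → Mat N
laplacianCycle N = symCirc N cycleCoeff

pCoeff : (M : ℕ) → (ℕ → ℚ) → ℕ → ℚ
pCoeff M d zero = sumIcc 1 M (λ i → ℕtoℚ i * d i)
pCoeff M d (suc i) with suc i ℕ.<? M
... | Relation.Nullary.yes _ = sumIcc (suc (suc i)) M (λ k → ℕtoℚ (k ∸ suc i) * d k)
... | Relation.Nullary.no _  = 0ℚ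

P-GS : (N M : ℕ) → (ℕ → ℚ) → Mat N
P-GS N M d = symCirc N (pCoeff M d)

PositiveDefinite : ∀ {N} → Mat N → Set
PositiveDefinite {N} P =
  (x : Fin N → ℚ) → Σ (Fin N) (λ i → x i ≢ 0ℚ) →
  0ℚ Data.Rational.< sumFin N (λ m → sumFin N (λ n → x m * P m n * x n))
  where
  open import Data.Product using (Σ)
  open import Relation.Binary.PropositionalEquality using (_≢_)

{-# OPTIONS --safe #-}

-- For every t, p_t = Σ_k (k ∸ t) d_k, so P_{G_S} is the combination, with weights d_k, of the
-- circulants whose entries are the ramps (k − δ)₊.  As 2M < N, all coefficient sequences involved
-- vanish on the far half of the cycle, and a circulant entry f(δ) at offset u is f(u) + f(N − u).
-- Multiplying by L_C takes a second difference along the cycle; that of the ramp (k − t)₊ is the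
-- Kronecker delta at t = k, which gives −d_δ off the diagonal, while 2(p₀ − p₁) = Σ 2d_k = d on it.
-- For definiteness, both xᵀ(k − δ)₊x and Σ_c (x_c + ⋯ + x_{c+k−1})² equal the sum over i, i′ < k
-- of the autocorrelation of x at |i − i′|; hence every term is ≥ 0, and the k = 1 term is
-- d₁ Σ x_c² > 0.

module Submission where

open import Defs

module CirculantLaplacian where
  open import Data.Nat as ℕ using (ℕ; zero; suc; _∸_; _⊓_; ∣_-_∣; z≤n; s≤s; _%_; NonZero)
  import Data.Nat.Properties as ℕₚ
  open import Data.Nat.DivMod using (m%n<n; m<n⇒m%n≡m; [m+n]%n≡m%n; %-distribˡ-+; m%n%n≡m%n; n%n≡0)
  import Data.Integer as ℤ
  open import Data.Rational as ℚ using (ℚ; 0ℚ; 1ℚ; _+_; _*_; -_; _-_; _≤_; _<_; toℚᵘ)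
  open import Data.Rational.Properties
    using (+-*-commutativeRing; _≟_; +-identityˡ; +-identityʳ; +-comm; +-assoc; *-comm; *-zeroˡ; *-zeroʳ;
           *-identityˡ; *-distribˡ-+; *-distribʳ-+; +-mono-≤; +-mono-<-≤; ≤-refl; ≤-total; <-cmp;
           nonNegative⁻¹; positive⁻¹; nonNeg*nonNeg⇒nonNeg; nonPos*nonPos⇒nonPos; pos*pos⇒pos; neg*neg⇒pos;
           toℚᵘ-injective; toℚᵘ-homo-+; toℚᵘ-fromℚᵘ)
  import Data.Rational.Unnormalised as ℚᵘ
  import Data.Rational.Unnormalised.Properties as ℚᵘₚ
  import Data.Integer.Properties as ℤₚ
  open import Data.Fin as Fin using (Fin; toℕ; fromℕ<)
  import Data.Fin.Properties as Finₚ
  open import Data.Product using (∃-syntax; _×_; _,_)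
  open import Data.Sum using (inj₁; inj₂)
  open import Data.Empty using (⊥-elim)
  open import Function using (_∘_)
  open import Relation.Nullary using (¬_; yes; no)
  import Relation.Nullary.Decidable.Core as Dec
  open import Relation.Binary.Definitions using (tri<; tri≈; tri>)
  open import Relation.Binary.PropositionalEquality
  open import Tactic.RingSolver using (solve-∀)
  open import Tactic.RingSolver.Core.AlmostCommutativeRing using (AlmostCommutativeRing; fromCommutativeRing)

  ℚ-ring : AlmostCommutativeRing _ _
  ℚ-ring = fromCommutativeRing +-*-commutativeRing (λ x → Dec.dec⇒maybe (0ℚ ≟ x))

  ℕtoℚ-+ : ∀ m n → ℕtoℚ (m ℕ.+ n) ≡ ℕtoℚ m + ℕtoℚ n
  ℕtoℚ-+ m n = toℚᵘ-injective (begin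
    toℚᵘ (ℕtoℚ (m ℕ.+ n))               ≈⟨ toℚᵘ-fromℚᵘ (ℕᵘ (m ℕ.+ n)) ⟩
    ℕᵘ (m ℕ.+ n)                        ≈⟨ ℚᵘ.*≡* (cong (ℤ._* ℤ.+ 1) (sym numerator)) ⟩
    ℕᵘ m ℚᵘ.+ ℕᵘ n                      ≈⟨ ℚᵘₚ.+-cong (ℚᵘₚ.≃-sym (toℚᵘ-fromℚᵘ (ℕᵘ m))) (ℚᵘₚ.≃-sym (toℚᵘ-fromℚᵘ (ℕᵘ n))) ⟩
    toℚᵘ (ℕtoℚ m) ℚᵘ.+ toℚᵘ (ℕtoℚ n)    ≈⟨ ℚᵘₚ.≃-sym (toℚᵘ-homo-+ (ℕtoℚ m) (ℕtoℚ n)) ⟩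
    toℚᵘ (ℕtoℚ m + ℕtoℚ n)              ∎)
    where
    open ℚᵘₚ.≃-Reasoning
    ℕᵘ : ℕ → ℚᵘ.ℚᵘ
    ℕᵘ k = ℚᵘ.mkℚᵘ (ℤ.+ k) 0
    numerator : ℤ.+ m ℤ.* ℤ.+ 1 ℤ.+ ℤ.+ n ℤ.* ℤ.+ 1 ≡ ℤ.+ m ℤ.+ ℤ.+ n
    numerator = cong₂ ℤ._+_ (ℤₚ.*-identityʳ (ℤ.+ m)) (ℤₚ.*-identityʳ (ℤ.+ n))

  ℕtoℚ-suc : ∀ n → ℕtoℚ (suc n) ≡ 1ℚ + ℕtoℚ n
  ℕtoℚ-suc = ℕtoℚ-+ 1

  +-nonneg : ∀ {a b} → 0ℚ ≤ a → 0ℚ ≤ b → 0ℚ ≤ a + b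
  +-nonneg {a} {b} 0≤a 0≤b = subst (_≤ a + b) (+-identityʳ 0ℚ) (+-mono-≤ 0≤a 0≤b)

  +-pos-nonneg : ∀ {a b} → 0ℚ < a → 0ℚ ≤ b → 0ℚ < a + b
  +-pos-nonneg {a} {b} 0<a 0≤b = subst (_< a + b) (+-identityʳ 0ℚ) (+-mono-<-≤ 0<a 0≤b)

  *-nonneg : ∀ {a b} → 0ℚ ≤ a → 0ℚ ≤ b → 0ℚ ≤ a * b
  *-nonneg {a} {b} 0≤a 0≤b =
    nonNegative⁻¹ (a * b) {{nonNeg*nonNeg⇒nonNeg a {{ℚ.nonNegative 0≤a}} b {{ℚ.nonNegative 0≤b}}}}

  *-pos : ∀ {a b} → 0ℚ < a → 0ℚ < b → 0ℚ < a * b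
  *-pos {a} {b} 0<a 0<b = positive⁻¹ (a * b) {{pos*pos⇒pos a {{ℚ.positive 0<a}} b {{ℚ.positive 0<b}}}}

  square-nonneg : ∀ y → 0ℚ ≤ y * y
  square-nonneg y with ≤-total 0ℚ y
  ... | inj₁ 0≤y = *-nonneg 0≤y 0≤y
  ... | inj₂ y≤0 = nonNegative⁻¹ (y * y) {{nonPos*nonPos⇒nonPos y {{ℚ.nonPositive y≤0}} y {{ℚ.nonPositive y≤0}}}}

  square-pos : ∀ y → ¬ y ≡ 0ℚ → 0ℚ < y * y
  square-pos y y≢0 with <-cmp y 0ℚ
  ... | tri< y<0 _ _ = positive⁻¹ (y * y) {{neg*neg⇒pos y {{ℚ.negative y<0}} y {{ℚ.negative y<0}}}}
  ... | tri≈ _ y≡0 _ = ⊥-elim (y≢0 y≡0)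
  ... | tri> _ _ 0<y = *-pos 0<y 0<y

  sumUpTo-cong : ∀ n {f g : ℕ → ℚ} → (∀ i → i ℕ.< n → f i ≡ g i) → sumUpTo n f ≡ sumUpTo n g
  sumUpTo-cong zero    f≗g = refl
  sumUpTo-cong (suc n) f≗g = cong₂ _+_ (sumUpTo-cong n (λ i i<n → f≗g i (ℕₚ.m<n⇒m<1+n i<n))) (f≗g n ℕₚ.≤-refl)

  sumUpTo-zero : ∀ n (f : ℕ → ℚ) → (∀ i → i ℕ.< n → f i ≡ 0ℚ) → sumUpTo n f ≡ 0ℚ
  sumUpTo-zero zero    f f≗0 = refl
  sumUpTo-zero (suc n) f f≗0 =
    cong₂ _+_ (sumUpTo-zero n f (λ i i<n → f≗0 i (ℕₚ.m<n⇒m<1+n i<n))) (f≗0 n ℕₚ.≤-refl)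

  sumUpTo-distrib-+ : ∀ n (f g : ℕ → ℚ) → sumUpTo n (λ i → f i + g i) ≡ sumUpTo n f + sumUpTo n g
  sumUpTo-distrib-+ zero    f g = refl
  sumUpTo-distrib-+ (suc n) f g = begin
    sumUpTo n (λ i → f i + g i) + (f n + g n)       ≡⟨ cong (_+ (f n + g n)) (sumUpTo-distrib-+ n f g) ⟩
    (sumUpTo n f + sumUpTo n g) + (f n + g n)       ≡⟨ interchange (sumUpTo n f) (sumUpTo n g) (f n) (g n) ⟩
    (sumUpTo n f + f n) + (sumUpTo n g + g n)       ∎
    where
    open ≡-Reasoning
    interchange : ∀ a b c d → (a + b) + (c + d) ≡ (a + c) + (b + d)
    interchange = solve-∀ ℚ-ring

  sumUpTo-distrib-minus : ∀ n (f g : ℕ → ℚ) → sumUpTo n (λ i → f i - g i) ≡ sumUpTo n f - sumUpTo n g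
  sumUpTo-distrib-minus zero    f g = refl
  sumUpTo-distrib-minus (suc n) f g = begin
    sumUpTo n (λ i → f i - g i) + (f n - g n)       ≡⟨ cong (_+ (f n - g n)) (sumUpTo-distrib-minus n f g) ⟩
    (sumUpTo n f - sumUpTo n g) + (f n - g n)       ≡⟨ interchange (sumUpTo n f) (sumUpTo n g) (f n) (g n) ⟩
    (sumUpTo n f + f n) - (sumUpTo n g + g n)       ∎
    where
    open ≡-Reasoning
    interchange : ∀ a b c d → (a - b) + (c - d) ≡ (a + c) - (b + d)
    interchange = solve-∀ ℚ-ring

  *-distribˡ-sumUpTo : ∀ n c (f : ℕ → ℚ) → c * sumUpTo n f ≡ sumUpTo n (λ i → c * f i)
  *-distribˡ-sumUpTo zero    c f = *-zeroʳ c
  *-distribˡ-sumUpTo (suc n) c f =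
    trans (*-distribˡ-+ c (sumUpTo n f) (f n)) (cong (_+ c * f n) (*-distribˡ-sumUpTo n c f))

  *-distribʳ-sumUpTo : ∀ n c (f : ℕ → ℚ) → sumUpTo n f * c ≡ sumUpTo n (λ i → f i * c)
  *-distribʳ-sumUpTo n c f =
    trans (*-comm (sumUpTo n f) c) (trans (*-distribˡ-sumUpTo n c f) (sumUpTo-cong n (λ i _ → *-comm c (f i))))

  sumUpTo-+ : ∀ a b (f : ℕ → ℚ) → sumUpTo (a ℕ.+ b) f ≡ sumUpTo a f + sumUpTo b (λ i → f (a ℕ.+ i))
  sumUpTo-+ a zero    f rewrite ℕₚ.+-identityʳ a = sym (+-identityʳ (sumUpTo a f))
  sumUpTo-+ a (suc b) f rewrite ℕₚ.+-suc a b =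
    trans (cong (_+ f (a ℕ.+ b)) (sumUpTo-+ a b f)) (+-assoc (sumUpTo a f) _ (f (a ℕ.+ b)))

  sumUpTo-suc-head : ∀ n (f : ℕ → ℚ) → sumUpTo (suc n) f ≡ f 0 + sumUpTo n (λ i → f (suc i))
  sumUpTo-suc-head n f = trans (sumUpTo-+ 1 n f) (cong (_+ sumUpTo n (λ i → f (suc i))) (+-identityˡ (f 0)))

  sumUpTo-truncate : ∀ {k n} → k ℕ.≤ n → (f : ℕ → ℚ) → (∀ i → k ℕ.≤ i → f i ≡ 0ℚ) →
                     sumUpTo n f ≡ sumUpTo k f
  sumUpTo-truncate {k} {n} k≤n f f≗0 = begin
    sumUpTo n f                                          ≡⟨ cong (λ m → sumUpTo m f) (sym (ℕₚ.m+[n∸m]≡n k≤n)) ⟩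
    sumUpTo (k ℕ.+ (n ∸ k)) f                            ≡⟨ sumUpTo-+ k (n ∸ k) f ⟩
    sumUpTo k f + sumUpTo (n ∸ k) (λ i → f (k ℕ.+ i))    ≡⟨ cong (sumUpTo k f +_) (sumUpTo-zero (n ∸ k) _ tail≗0) ⟩
    sumUpTo k f + 0ℚ                                     ≡⟨ +-identityʳ (sumUpTo k f) ⟩
    sumUpTo k f                                          ∎
    where
    open ≡-Reasoning
    tail≗0 : ∀ i → i ℕ.< n ∸ k → f (k ℕ.+ i) ≡ 0ℚ
    tail≗0 i _ = f≗0 (k ℕ.+ i) (ℕₚ.m≤m+n k i)

  sumUpTo-comm : ∀ m n (F : ℕ → ℕ → ℚ) →
                 sumUpTo m (λ i → sumUpTo n (F i)) ≡ sumUpTo n (λ j → sumUpTo m (λ i → F i j))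
  sumUpTo-comm zero    n F = sym (sumUpTo-zero n _ (λ _ _ → refl))
  sumUpTo-comm (suc m) n F =
    trans (cong (_+ sumUpTo n (F m)) (sumUpTo-comm m n F)) (sym (sumUpTo-distrib-+ n _ (F m)))

  sumUpTo-reverse : ∀ n (f : ℕ → ℚ) → sumUpTo n (λ u → f (n ∸ u)) ≡ sumUpTo n (λ v → f (suc v))
  sumUpTo-reverse zero    f = refl
  sumUpTo-reverse (suc n) f = begin
    sumUpTo n (λ u → f (suc n ∸ u)) + f (suc n ∸ n)
      ≡⟨ cong₂ _+_ (sumUpTo-cong n (λ u u<n → cong f (ℕₚ.+-∸-assoc 1 (ℕₚ.<⇒≤ u<n)))) (cong f (ℕₚ.m+n∸n≡m 1 n)) ⟩
    sumUpTo n (λ u → f (suc (n ∸ u))) + f 1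
      ≡⟨ cong (_+ f 1) (sumUpTo-reverse n (λ k → f (suc k))) ⟩
    sumUpTo n (λ v → f (suc (suc v))) + f 1
      ≡⟨ +-comm _ (f 1) ⟩
    f 1 + sumUpTo n (λ v → f (suc (suc v)))
      ≡⟨ sym (sumUpTo-suc-head n (λ v → f (suc v))) ⟩
    sumUpTo (suc n) (λ v → f (suc v)) ∎
    where open ≡-Reasoning

  sumFin-cong : ∀ n {f g : Fin n → ℚ} → (∀ k → f k ≡ g k) → sumFin n f ≡ sumFin n g
  sumFin-cong zero    f≗g = refl
  sumFin-cong (suc n) f≗g = cong₂ _+_ (f≗g Fin.zero) (sumFin-cong n (f≗g ∘ Fin.suc))

  sumFin-toℕ : ∀ n (f : ℕ → ℚ) → sumFin n (λ k → f (toℕ k)) ≡ sumUpTo n f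
  sumFin-toℕ zero    f = refl
  sumFin-toℕ (suc n) f = trans (cong (f 0 +_) (sumFin-toℕ n (λ i → f (suc i)))) (sym (sumUpTo-suc-head n f))

  sumUpTo-nonneg : ∀ n (f : ℕ → ℚ) → (∀ i → i ℕ.< n → 0ℚ ≤ f i) → 0ℚ ≤ sumUpTo n f
  sumUpTo-nonneg zero    f 0≤f = ≤-refl
  sumUpTo-nonneg (suc n) f 0≤f =
    +-nonneg (sumUpTo-nonneg n f (λ i i<n → 0≤f i (ℕₚ.m<n⇒m<1+n i<n))) (0≤f n ℕₚ.≤-refl)

  sumUpTo-pos : ∀ n (f : ℕ → ℚ) → (∀ i → i ℕ.< n → 0ℚ ≤ f i) → ∀ j → j ℕ.< n → 0ℚ < f j →
                0ℚ < sumUpTo n f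
  sumUpTo-pos (suc n) f 0≤f j j<1+n 0<fj with j ℕ.≟ n
  ... | yes refl = subst (0ℚ <_) (+-comm (f j) _)
                     (+-pos-nonneg 0<fj (sumUpTo-nonneg j f (λ i i<j → 0≤f i (ℕₚ.m<n⇒m<1+n i<j))))
  ... | no j≢n   = +-pos-nonneg
                     (sumUpTo-pos n f (λ i i<n → 0≤f i (ℕₚ.m<n⇒m<1+n i<n)) j (ℕₚ.≤∧≢⇒< (ℕ.s≤s⁻¹ j<1+n) j≢n) 0<fj)
                     (0≤f n ℕₚ.≤-refl)

  kronecker : ℕ → ℕ → ℚ
  kronecker zero    zero    = 1ℚ
  kronecker zero    (suc _) = 0ℚ
  kronecker (suc _) zero    = 0ℚ
  kronecker (suc a) (suc b) = kronecker a b

  kronecker-refl : ∀ a → kronecker a a ≡ 1ℚ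
  kronecker-refl zero    = refl
  kronecker-refl (suc a) = kronecker-refl a

  kronecker-≢ : ∀ {a b} → a ≢ b → kronecker a b ≡ 0ℚ
  kronecker-≢ {zero}  {zero}  a≢b = ⊥-elim (a≢b refl)
  kronecker-≢ {zero}  {suc b} a≢b = refl
  kronecker-≢ {suc a} {zero}  a≢b = refl
  kronecker-≢ {suc a} {suc b} a≢b = kronecker-≢ (a≢b ∘ cong suc)

  sumUpTo-kronecker-out : ∀ n (g : ℕ → ℚ) s → n ℕ.≤ s → sumUpTo n (λ j → kronecker j s * g j) ≡ 0ℚ
  sumUpTo-kronecker-out n g s n≤s = sumUpTo-zero n _ λ j j<n →
    trans (cong (_* g j) (kronecker-≢ (ℕₚ.<⇒≢ (ℕₚ.<-≤-trans j<n n≤s)))) (*-zeroˡ (g j))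

  sumUpTo-kronecker : ∀ n (g : ℕ → ℚ) s → (n ℕ.≤ s → g s ≡ 0ℚ) → sumUpTo n (λ j → kronecker j s * g j) ≡ g s
  sumUpTo-kronecker zero    g s gs≡0 = sym (gs≡0 z≤n)
  sumUpTo-kronecker (suc n) g s gs≡0 with s ℕ.≟ n
  ... | yes refl = begin
    sumUpTo s (λ j → kronecker j s * g j) + kronecker s s * g s
      ≡⟨ cong₂ _+_ (sumUpTo-kronecker-out s g s ℕₚ.≤-refl) (cong (_* g s) (kronecker-refl s)) ⟩
    0ℚ + 1ℚ * g s
      ≡⟨ trans (+-identityˡ _) (*-identityˡ (g s)) ⟩
    g s ∎
    where open ≡-Reasoning
  ... | no s≢n = begin
    sumUpTo n (λ j → kronecker j s * g j) + kronecker n s * g n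
      ≡⟨ cong₂ _+_ (sumUpTo-kronecker n g s (gs≡0 ∘ n≤s⇒1+n≤s)) (cong (_* g n) (kronecker-≢ (s≢n ∘ sym))) ⟩
    g s + 0ℚ * g n
      ≡⟨ trans (cong (g s +_) (*-zeroˡ (g n))) (+-identityʳ (g s)) ⟩
    g s ∎
    where
    open ≡-Reasoning
    n≤s⇒1+n≤s : n ℕ.≤ s → suc n ℕ.≤ s
    n≤s⇒1+n≤s n≤s = ℕₚ.≤∧≢⇒< n≤s (s≢n ∘ sym)

  ramp : ℕ → ℕ → ℚ
  ramp k t = ℕtoℚ (k ∸ t)

  ramp-vanishing : ∀ {k t} → k ℕ.≤ t → ramp k t ≡ 0ℚ
  ramp-vanishing k≤t = cong ℕtoℚ (ℕₚ.m≤n⇒m∸n≡0 k≤t)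

  Δ : (ℕ → ℚ) → ℕ → ℚ
  Δ f s = f s - f (suc s)

  Δ² : (ℕ → ℚ) → ℕ → ℚ
  Δ² f s = Δ f s - Δ f (suc s)

  Δ-sumUpTo : ∀ n (g : ℕ → ℕ → ℚ) s → Δ (λ t → sumUpTo n (λ j → g j t)) s ≡ sumUpTo n (λ j → Δ (g j) s)
  Δ-sumUpTo n g s = sym (sumUpTo-distrib-minus n (λ j → g j s) (λ j → g j (suc s)))

  Δ²-sumUpTo : ∀ n (g : ℕ → ℕ → ℚ) s → Δ² (λ t → sumUpTo n (λ j → g j t)) s ≡ sumUpTo n (λ j → Δ² (g j) s)
  Δ²-sumUpTo n g s = trans (cong₂ _-_ (Δ-sumUpTo n g s) (Δ-sumUpTo n g (suc s)))
                           (sym (sumUpTo-distrib-minus n (λ j → Δ (g j) s) (λ j → Δ (g j) (suc s))))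

  Δ-*ʳ : ∀ (f : ℕ → ℚ) c s → Δ (λ t → f t * c) s ≡ Δ f s * c
  Δ-*ʳ f c s = distrib (f s) (f (suc s)) c
    where
    distrib : ∀ a b c → a * c - b * c ≡ (a - b) * c
    distrib = solve-∀ ℚ-ring

  Δ²-*ʳ : ∀ (f : ℕ → ℚ) c s → Δ² (λ t → f t * c) s ≡ Δ² f s * c
  Δ²-*ʳ f c s = trans (cong₂ _-_ (Δ-*ʳ f c s) (Δ-*ʳ f c (suc s))) (Δ-*ʳ (Δ f) c s)

  Δ-ramp-suc : ∀ j → Δ (ramp (suc j)) 0 ≡ 1ℚ
  Δ-ramp-suc j = trans (cong (_- ℕtoℚ j) (ℕtoℚ-suc j)) (cancel 1ℚ (ℕtoℚ j))
    where
    cancel : ∀ a b → (a + b) - b ≡ a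
    cancel = solve-∀ ℚ-ring

  Δ²-ramp : ∀ k s → Δ² (ramp k) s ≡ kronecker k (suc s)
  Δ²-ramp zero          zero    = refl
  Δ²-ramp zero          (suc s) = refl
  Δ²-ramp (suc zero)    zero    = refl
  Δ²-ramp (suc (suc k)) zero    = begin
    (ℕtoℚ (2 ℕ.+ k) - ℕtoℚ (1 ℕ.+ k)) - (ℕtoℚ (1 ℕ.+ k) - ℕtoℚ k)
      ≡⟨ cong₂ (λ a b → (a - b) - (b - ℕtoℚ k)) (trans (ℕtoℚ-suc (suc k)) (cong (1ℚ +_) (ℕtoℚ-suc k))) (ℕtoℚ-suc k) ⟩
    ((1ℚ + (1ℚ + ℕtoℚ k)) - (1ℚ + ℕtoℚ k)) - ((1ℚ + ℕtoℚ k) - ℕtoℚ k)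
      ≡⟨ second-difference-linear (ℕtoℚ k) ⟩
    0ℚ ∎
    where
    open ≡-Reasoning
    second-difference-linear : ∀ x → ((1ℚ + (1ℚ + x)) - (1ℚ + x)) - ((1ℚ + x) - x) ≡ 0ℚ
    second-difference-linear = solve-∀ ℚ-ring
  Δ²-ramp (suc k)       (suc s) = Δ²-ramp k s

  module Coefficients (M : ℕ) (d : ℕ → ℚ) where

    p̂ : ℕ → ℚ
    p̂ t = sumUpTo M (λ j → ramp (suc j) t * d (suc j))

    term-vanishing : ∀ {j t} → j ℕ.< t → ramp (suc j) t * d (suc j) ≡ 0ℚ
    term-vanishing j<t = trans (cong (_* d _) (ramp-vanishing j<t)) (*-zeroˡ (d _))

    p̂-vanishing : ∀ t → M ℕ.≤ t → p̂ t ≡ 0ℚ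
    p̂-vanishing t M≤t = sumUpTo-zero M _ (λ j j<M → term-vanishing (ℕₚ.<-≤-trans j<M M≤t))

    pCoeff≡p̂ : ∀ t → pCoeff M d t ≡ p̂ t
    pCoeff≡p̂ zero = refl
    pCoeff≡p̂ (suc i) with suc i ℕ.<? M
    ... | no 1+i≮M = sym (p̂-vanishing (suc i) (ℕₚ.≮⇒≥ 1+i≮M))
    ... | yes 1+i<M = sym (begin
      sumUpTo M term                           ≡⟨ cong (λ k → sumUpTo k term) (sym (ℕₚ.m+[n∸m]≡n (ℕₚ.<⇒≤ 1+i<M))) ⟩
      sumUpTo (suc i ℕ.+ (M ∸ suc i)) term     ≡⟨ sumUpTo-+ (suc i) (M ∸ suc i) term ⟩
      sumUpTo (suc i) term + tail              ≡⟨ cong (_+ tail) (sumUpTo-zero (suc i) term (λ _ → term-vanishing)) ⟩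
      0ℚ + tail                                ≡⟨ +-identityˡ tail ⟩
      tail                                     ∎)
      where
      open ≡-Reasoning
      term : ℕ → ℚ
      term j = ramp (suc j) (suc i) * d (suc j)
      tail = sumUpTo (M ∸ suc i) (λ k → term (suc i ℕ.+ k))

    degree≡2Δp̂ : degree M d ≡ ℕtoℚ 2 * Δ p̂ 0
    degree≡2Δp̂ = begin
      sumUpTo M (λ j → ℕtoℚ 2 * d (suc j))
        ≡⟨ sym (*-distribˡ-sumUpTo M (ℕtoℚ 2) (λ j → d (suc j))) ⟩
      ℕtoℚ 2 * sumUpTo M (λ j → d (suc j))
        ≡⟨ cong (ℕtoℚ 2 *_) (sumUpTo-cong M (λ j _ → sym (Δ-term j))) ⟩
      ℕtoℚ 2 * sumUpTo M (λ j → Δ (λ t → ramp (suc j) t * d (suc j)) 0)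
        ≡⟨ cong (ℕtoℚ 2 *_) (sym (Δ-sumUpTo M (λ j t → ramp (suc j) t * d (suc j)) 0)) ⟩
      ℕtoℚ 2 * Δ p̂ 0 ∎
      where
      open ≡-Reasoning
      Δ-term : ∀ j → Δ (λ t → ramp (suc j) t * d (suc j)) 0 ≡ d (suc j)
      Δ-term j = trans (Δ-*ʳ (ramp (suc j)) (d (suc j)) 0)
                       (trans (cong (_* d (suc j)) (Δ-ramp-suc j)) (*-identityˡ (d (suc j))))

    Δ²p̂ : (∀ t → M ℕ.< t → d t ≡ 0ℚ) → ∀ s → Δ² p̂ s ≡ d (suc s)
    Δ²p̂ d-vanishing s = begin
      Δ² p̂ s
        ≡⟨ Δ²-sumUpTo M (λ j t → ramp (suc j) t * d (suc j)) s ⟩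
      sumUpTo M (λ j → Δ² (λ t → ramp (suc j) t * d (suc j)) s)
        ≡⟨ sumUpTo-cong M (λ j _ → trans (Δ²-*ʳ (ramp (suc j)) (d (suc j)) s) (cong (_* d (suc j)) (Δ²-ramp (suc j) s))) ⟩
      sumUpTo M (λ j → kronecker j s * d (suc j))
        ≡⟨ sumUpTo-kronecker M (λ j → d (suc j)) s (λ M≤s → d-vanishing (suc s) (s≤s M≤s)) ⟩
      d (suc s) ∎
      where open ≡-Reasoning

  module Cyclic (N : ℕ) .{{_ : NonZero N}} where

    infixl 6 _⊕_

    _⊕_ : ℕ → ℕ → ℕ
    a ⊕ b = (a ℕ.+ b) % N

    dist₀ : ℕ → ℕ
    dist₀ u = u ⊓ (N ∸ u)

    dist : ℕ → ℕ → ℕ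
    dist a b = dist₀ ∣ a - b ∣

    ⊕<N : ∀ a b → a ⊕ b ℕ.< N
    ⊕<N a b = m%n<n (a ℕ.+ b) N

    +<N⇒⊕≡+ : ∀ a b → a ℕ.+ b ℕ.< N → a ⊕ b ≡ a ℕ.+ b
    +<N⇒⊕≡+ a b = m<n⇒m%n≡m

    +≡N+w⇒⊕≡w : ∀ a b {w} → a ℕ.+ b ≡ N ℕ.+ w → w ℕ.< N → a ⊕ b ≡ w
    +≡N+w⇒⊕≡w a b {w} a+b≡N+w w<N = begin
      (a ℕ.+ b) % N   ≡⟨ cong (_% N) (trans a+b≡N+w (ℕₚ.+-comm N w)) ⟩
      (w ℕ.+ N) % N   ≡⟨ [m+n]%n≡m%n w N ⟩
      w % N           ≡⟨ m<n⇒m%n≡m w<N ⟩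
      w               ∎
      where open ≡-Reasoning

    ⊕-comm : ∀ a b → a ⊕ b ≡ b ⊕ a
    ⊕-comm a b = cong (_% N) (ℕₚ.+-comm a b)

    ⊕-identityʳ : ∀ {a} → a ℕ.< N → a ⊕ 0 ≡ a
    ⊕-identityʳ {a} a<N = trans (cong (_% N) (ℕₚ.+-identityʳ a)) (m<n⇒m%n≡m a<N)

    %-absorbˡ : ∀ x y → (x % N ℕ.+ y) % N ≡ (x ℕ.+ y) % N
    %-absorbˡ x y = begin
      (x % N ℕ.+ y) % N           ≡⟨ %-distribˡ-+ (x % N) y N ⟩
      (x % N % N ℕ.+ y % N) % N   ≡⟨ cong (λ z → (z ℕ.+ y % N) % N) (m%n%n≡m%n x N) ⟩
      (x % N ℕ.+ y % N) % N       ≡⟨ sym (%-distribˡ-+ x y N) ⟩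
      (x ℕ.+ y) % N               ∎
      where open ≡-Reasoning

    ⊕-assoc : ∀ a b c → (a ⊕ b) ⊕ c ≡ a ⊕ (b ⊕ c)
    ⊕-assoc a b c = begin
      (a ⊕ b) ⊕ c             ≡⟨ %-absorbˡ (a ℕ.+ b) c ⟩
      (a ℕ.+ b ℕ.+ c) % N     ≡⟨ cong (_% N) (trans (ℕₚ.+-assoc a b c) (ℕₚ.+-comm a (b ℕ.+ c))) ⟩
      (b ℕ.+ c ℕ.+ a) % N     ≡⟨ sym (%-absorbˡ (b ℕ.+ c) a) ⟩
      (b ⊕ c) ⊕ a             ≡⟨ ⊕-comm (b ⊕ c) a ⟩
      a ⊕ (b ⊕ c)             ∎
      where open ≡-Reasoning

    ⊕-inverseʳ : ∀ {u} → u ℕ.≤ N → u ⊕ (N ∸ u) ≡ 0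
    ⊕-inverseʳ {u} u≤N = trans (cong (_% N) (ℕₚ.m+[n∸m]≡n u≤N)) (n%n≡0 N)

    sumUpTo-⊕ : ∀ {u} → u ℕ.≤ N → (f : ℕ → ℚ) → sumUpTo N (λ m → f (m ⊕ u)) ≡ sumUpTo N f
    sumUpTo-⊕ {u} u≤N f = begin
      sumUpTo N (λ m → f (m ⊕ u))
        ≡⟨ cong (λ k → sumUpTo k (λ m → f (m ⊕ u))) (sym N∸u+u≡N) ⟩
      sumUpTo ((N ∸ u) ℕ.+ u) (λ m → f (m ⊕ u))
        ≡⟨ sumUpTo-+ (N ∸ u) u _ ⟩
      sumUpTo (N ∸ u) (λ m → f (m ⊕ u)) + sumUpTo u (λ i → f ((N ∸ u) ℕ.+ i ⊕ u))
        ≡⟨ cong₂ _+_ (sumUpTo-cong (N ∸ u) (λ m m<N∸u → cong f (trans (+<N⇒⊕≡+ m u (no-wrap m<N∸u)) (ℕₚ.+-comm m u))))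
                     (sumUpTo-cong u (λ i i<u → cong f (+≡N+w⇒⊕≡w _ u (wrap i) (ℕₚ.<-≤-trans i<u u≤N)))) ⟩
      sumUpTo (N ∸ u) (λ m → f (u ℕ.+ m)) + sumUpTo u f
        ≡⟨ +-comm _ (sumUpTo u f) ⟩
      sumUpTo u f + sumUpTo (N ∸ u) (λ m → f (u ℕ.+ m))
        ≡⟨ sym (sumUpTo-+ u (N ∸ u) f) ⟩
      sumUpTo (u ℕ.+ (N ∸ u)) f
        ≡⟨ cong (λ k → sumUpTo k f) (ℕₚ.m+[n∸m]≡n u≤N) ⟩
      sumUpTo N f ∎
      where
      open ≡-Reasoning
      N∸u+u≡N : (N ∸ u) ℕ.+ u ≡ N
      N∸u+u≡N = ℕₚ.m∸n+n≡m u≤N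
      no-wrap : ∀ {m} → m ℕ.< N ∸ u → m ℕ.+ u ℕ.< N
      no-wrap {m} m<N∸u = subst (m ℕ.+ u ℕ.<_) N∸u+u≡N (ℕₚ.+-monoˡ-< u m<N∸u)
      wrap : ∀ i → (N ∸ u) ℕ.+ i ℕ.+ u ≡ N ℕ.+ i
      wrap i = begin
        (N ∸ u) ℕ.+ i ℕ.+ u     ≡⟨ ℕₚ.+-assoc (N ∸ u) i u ⟩
        (N ∸ u) ℕ.+ (i ℕ.+ u)   ≡⟨ cong ((N ∸ u) ℕ.+_) (ℕₚ.+-comm i u) ⟩
        (N ∸ u) ℕ.+ (u ℕ.+ i)   ≡⟨ sym (ℕₚ.+-assoc (N ∸ u) u i) ⟩
        (N ∸ u) ℕ.+ u ℕ.+ i     ≡⟨ cong (ℕ._+ i) N∸u+u≡N ⟩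
        N ℕ.+ i                 ∎

    dist₀-N∸u : ∀ {u} → u ℕ.≤ N → dist₀ (N ∸ u) ≡ dist₀ u
    dist₀-N∸u {u} u≤N = trans (cong ((N ∸ u) ⊓_) (ℕₚ.m∸[m∸n]≡n u≤N)) (ℕₚ.⊓-comm (N ∸ u) u)

    dist-comm : ∀ a b → dist a b ≡ dist b a
    dist-comm a b = cong dist₀ (ℕₚ.∣-∣-comm a b)

    dist-⊕ : ∀ {a u} → a ℕ.< N → u ℕ.< N → dist a (a ⊕ u) ≡ dist₀ u
    dist-⊕ {a} {u} a<N u<N with a ℕ.+ u ℕ.<? N
    ... | yes a+u<N = cong dist₀ (trans (cong (λ z → ∣ a - z ∣) (+<N⇒⊕≡+ a u a+u<N)) (ℕₚ.∣m-m+n∣≡n a u))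
    ... | no a+u≮N  = trans (cong dist₀ ∣a-a⊕u∣≡N∸u) (dist₀-N∸u (ℕₚ.<⇒≤ u<N))
      where
      w = a ℕ.+ u ∸ N
      a+u≡N+w : a ℕ.+ u ≡ N ℕ.+ w
      a+u≡N+w = sym (ℕₚ.m+[n∸m]≡n (ℕₚ.≮⇒≥ a+u≮N))
      w<N : w ℕ.< N
      w<N = ℕₚ.+-cancelˡ-< N w N (subst (ℕ._< N ℕ.+ N) a+u≡N+w (ℕₚ.+-mono-< a<N u<N))
      w≤a : w ℕ.≤ a
      w≤a = ℕₚ.m≤n+o⇒m∸n≤o (a ℕ.+ u) N (subst (a ℕ.+ u ℕ.≤_) (ℕₚ.+-comm a N) (ℕₚ.+-monoʳ-≤ a (ℕₚ.<⇒≤ u<N)))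
      ∣a-a⊕u∣≡N∸u : ∣ a - a ⊕ u ∣ ≡ N ∸ u
      ∣a-a⊕u∣≡N∸u = begin
        ∣ a - a ⊕ u ∣           ≡⟨ cong (λ z → ∣ a - z ∣) (+≡N+w⇒⊕≡w a u a+u≡N+w w<N) ⟩
        ∣ a - w ∣               ≡⟨ ℕₚ.m≤n⇒∣n-m∣≡n∸m w≤a ⟩
        a ∸ w                   ≡⟨ sym (ℕₚ.[m+n]∸[m+o]≡n∸o u a w) ⟩
        u ℕ.+ a ∸ (u ℕ.+ w)     ≡⟨ cong₂ _∸_ (trans (ℕₚ.+-comm u a) a+u≡N+w) (ℕₚ.+-comm u w) ⟩
        N ℕ.+ w ∸ (w ℕ.+ u)     ≡⟨ cong (_∸ (w ℕ.+ u)) (ℕₚ.+-comm N w) ⟩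
        w ℕ.+ N ∸ (w ℕ.+ u)     ≡⟨ ℕₚ.[m+n]∸[m+o]≡n∸o w N u ⟩
        N ∸ u                   ∎
        where open ≡-Reasoning

    ⊕-surjective : ∀ {a b} → a ℕ.< N → b ℕ.< N → ∃[ r ] r ℕ.< N × b ≡ a ⊕ r
    ⊕-surjective {a} {b} a<N b<N with a ℕ.≤? b
    ... | yes a≤b = b ∸ a , ℕₚ.≤-<-trans (ℕₚ.m∸n≤m b a) b<N , sym a⊕[b∸a]≡b
      where
      a+[b∸a]≡b : a ℕ.+ (b ∸ a) ≡ b
      a+[b∸a]≡b = ℕₚ.m+[n∸m]≡n a≤b
      a⊕[b∸a]≡b : a ⊕ (b ∸ a) ≡ b
      a⊕[b∸a]≡b = trans (+<N⇒⊕≡+ a (b ∸ a) (subst (ℕ._< N) (sym a+[b∸a]≡b) b<N)) a+[b∸a]≡b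
    ... | no a≰b = (N ∸ a) ℕ.+ b , r<N , sym (+≡N+w⇒⊕≡w a _ a+r≡N+b b<N)
      where
      a+r≡N+b : a ℕ.+ ((N ∸ a) ℕ.+ b) ≡ N ℕ.+ b
      a+r≡N+b = trans (sym (ℕₚ.+-assoc a (N ∸ a) b)) (cong (ℕ._+ b) (ℕₚ.m+[n∸m]≡n (ℕₚ.<⇒≤ a<N)))
      r<N : (N ∸ a) ℕ.+ b ℕ.< N
      r<N = subst ((N ∸ a) ℕ.+ b ℕ.<_) (ℕₚ.m∸n+n≡m (ℕₚ.<⇒≤ a<N)) (ℕₚ.+-monoʳ-< (N ∸ a) (ℕₚ.≰⇒> a≰b))

    HalfSupported : (ℕ → ℚ) → Set
    HalfSupported f = ∀ t → N ℕ.≤ t ℕ.+ t → f t ≡ 0ℚ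

    vanishing⇒halfSupported : ∀ {K} (f : ℕ → ℚ) → K ℕ.+ K ℕ.≤ suc N → (∀ t → K ℕ.≤ t → f t ≡ 0ℚ) →
                              HalfSupported f
    vanishing⇒halfSupported {K} f 2K≤1+N f≗0 t N≤2t = f≗0 t (ℕₚ.≮⇒≥ t≮K)
      where
      t≮K : ¬ t ℕ.< K
      t≮K t<K = ℕₚ.<-irrefl refl (begin-strict
        suc (t ℕ.+ t)     <⟨ ℕₚ.≤-reflexive (cong suc (sym (ℕₚ.+-suc t t))) ⟩
        suc t ℕ.+ suc t   ≤⟨ ℕₚ.+-mono-≤ t<K t<K ⟩
        K ℕ.+ K           ≤⟨ 2K≤1+N ⟩
        suc N             ≤⟨ s≤s N≤2t ⟩
        suc (t ℕ.+ t)     ∎)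
        where open ℕₚ.≤-Reasoning

    sum± : (ℕ → ℚ) → ℕ → ℚ
    sum± f u = f u + f (N ∸ u)

    halfSupported⇒f∘dist₀≡sum± : ∀ {f} → HalfSupported f → ∀ {u} → u ℕ.≤ N → f (dist₀ u) ≡ sum± f u
    halfSupported⇒f∘dist₀≡sum± {f} f-half {u} u≤N with u ℕ.≤? N ∸ u
    ... | yes u≤N∸u = begin
      f (u ⊓ (N ∸ u))      ≡⟨ cong f (ℕₚ.m≤n⇒m⊓n≡m u≤N∸u) ⟩
      f u                  ≡⟨ sym (+-identityʳ (f u)) ⟩
      f u + 0ℚ             ≡⟨ cong (f u +_) (sym (f-half (N ∸ u) N≤2[N∸u])) ⟩
      f u + f (N ∸ u)      ∎
      where
      open ≡-Reasoning
      N≤2[N∸u] : N ℕ.≤ (N ∸ u) ℕ.+ (N ∸ u)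
      N≤2[N∸u] = subst (ℕ._≤ (N ∸ u) ℕ.+ (N ∸ u)) (ℕₚ.m+[n∸m]≡n u≤N) (ℕₚ.+-monoˡ-≤ (N ∸ u) u≤N∸u)
    ... | no u≰N∸u = begin
      f (u ⊓ (N ∸ u))      ≡⟨ cong f (ℕₚ.m≥n⇒m⊓n≡n N∸u≤u) ⟩
      f (N ∸ u)            ≡⟨ sym (+-identityˡ (f (N ∸ u))) ⟩
      0ℚ + f (N ∸ u)       ≡⟨ cong (_+ f (N ∸ u)) (sym (f-half u N≤2u)) ⟩
      f u + f (N ∸ u)      ∎
      where
      open ≡-Reasoning
      N∸u≤u : N ∸ u ℕ.≤ u
      N∸u≤u = ℕₚ.<⇒≤ (ℕₚ.≰⇒> u≰N∸u)
      N≤2u : N ℕ.≤ u ℕ.+ u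
      N≤2u = subst (ℕ._≤ u ℕ.+ u) (ℕₚ.m+[n∸m]≡n u≤N) (ℕₚ.+-monoʳ-≤ u N∸u≤u)

    dist₀-⊕1 : ∀ {r} → r ℕ.< N → dist₀ (r ⊕ 1) ≡ dist₀ (suc r)
    dist₀-⊕1 {r} r<N with r ℕ.+ 1 ℕ.<? N
    ... | yes r+1<N = cong dist₀ (trans (+<N⇒⊕≡+ r 1 r+1<N) (ℕₚ.+-comm r 1))
    ... | no r+1≮N  = begin
      dist₀ (r ⊕ 1)   ≡⟨ cong dist₀ (+≡N+w⇒⊕≡w r 1 r+1≡N+0 (ℕₚ.n≢0⇒n>0 (ℕ.≢-nonZero⁻¹ N))) ⟩
      dist₀ 0         ≡⟨ sym (trans (cong (N ⊓_) (ℕₚ.n∸n≡0 N)) (ℕₚ.⊓-zeroʳ N)) ⟩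
      dist₀ N         ≡⟨ cong dist₀ (sym 1+r≡N) ⟩
      dist₀ (suc r)   ∎
      where
      open ≡-Reasoning
      1+r≡N : suc r ≡ N
      1+r≡N = ℕₚ.≤-antisym r<N (subst (N ℕ.≤_) (ℕₚ.+-comm r 1) (ℕₚ.≮⇒≥ r+1≮N))
      r+1≡N+0 : r ℕ.+ 1 ≡ N ℕ.+ 0
      r+1≡N+0 = trans (ℕₚ.+-comm r 1) (trans 1+r≡N (sym (ℕₚ.+-identityʳ N)))

    suc⊕N∸1 : ∀ {r} → r ℕ.< N → suc r ⊕ (N ∸ 1) ≡ r
    suc⊕N∸1 {r} r<N = +≡N+w⇒⊕≡w (suc r) (N ∸ 1) 1+r+[N∸1]≡N+r r<N
      where
      1+r+[N∸1]≡N+r : suc r ℕ.+ (N ∸ 1) ≡ N ℕ.+ r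
      1+r+[N∸1]≡N+r = trans (sym (ℕₚ.+-suc r (N ∸ 1))) (trans (cong (r ℕ.+_) (ℕₚ.suc-pred N)) (ℕₚ.+-comm r N))

    N∸r≡1+[N∸1+r] : ∀ {r} → r ℕ.< N → N ∸ r ≡ suc (N ∸ suc r)
    N∸r≡1+[N∸1+r] {r} r<N = begin
      N ∸ r                  ≡⟨ sym (ℕₚ.suc-pred (N ∸ r) {{ℕ.>-nonZero (ℕₚ.m<n⇒0<n∸m r<N)}}) ⟩
      suc (ℕ.pred (N ∸ r))   ≡⟨ cong suc (ℕₚ.pred[m∸n]≡m∸[1+n] N r) ⟩
      suc (N ∸ suc r)        ∎
      where open ≡-Reasoning

    sum±-second-difference : ∀ (f : ℕ → ℚ) {r} → suc r ℕ.< N →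
      ℕtoℚ 2 * sum± f (suc r) - sum± f (suc (suc r)) - sum± f r ≡ - (Δ² f r + Δ² f (N ∸ suc (suc r)))
    sum±-second-difference f {r} 1+r<N = begin
      ℕtoℚ 2 * (f (suc r) + f (N ∸ suc r)) - (f (suc (suc r)) + f q) - (f r + f (N ∸ r))
        ≡⟨ cong₂ (λ x y → ℕtoℚ 2 * (f (suc r) + f x) - (f (suc (suc r)) + f q) - (f r + f y))
                 N∸[1+r]≡1+q N∸r≡2+q ⟩
      ℕtoℚ 2 * (f (suc r) + f (suc q)) - (f (suc (suc r)) + f q) - (f r + f (suc (suc q)))
        ≡⟨ regroup (f r) (f (suc r)) (f (suc (suc r))) (f q) (f (suc q)) (f (suc (suc q))) ⟩
      - (Δ² f r + Δ² f q) ∎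
      where
      open ≡-Reasoning
      q = N ∸ suc (suc r)
      N∸[1+r]≡1+q : N ∸ suc r ≡ suc q
      N∸[1+r]≡1+q = N∸r≡1+[N∸1+r] 1+r<N
      N∸r≡2+q : N ∸ r ≡ suc (suc q)
      N∸r≡2+q = trans (N∸r≡1+[N∸1+r] (ℕₚ.<-trans (ℕₚ.n<1+n r) 1+r<N)) (cong suc N∸[1+r]≡1+q)
      regroup : ∀ a b c x y z → (1ℚ + 1ℚ) * (b + y) - (c + x) - (a + z) ≡ - (((a - b) - (b - c)) + ((x - y) - (y - z)))
      regroup = solve-∀ ℚ-ring

  module CycleProduct (n : ℕ) where

    -- N ≥ 3, so that L_C has its three nonzero entries at the distinct offsets 0, 1 and N − 1.
    N : ℕ
    N = suc (suc (suc n))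

    open Cyclic N

    cycleCoeff-vanishing : ∀ t → 2 ℕ.≤ t → cycleCoeff t ≡ 0ℚ
    cycleCoeff-vanishing (suc zero)    (s≤s ())
    cycleCoeff-vanishing (suc (suc t)) _ = refl

    cycleCoeff-halfSupported : HalfSupported cycleCoeff
    cycleCoeff-halfSupported = vanishing⇒halfSupported cycleCoeff (ℕₚ.m≤m+n 4 n) cycleCoeff-vanishing

    sumUpTo-*-sum±cycleCoeff : ∀ (G : ℕ → ℚ) →
      sumUpTo N (λ u → G u * sum± cycleCoeff u) ≡ ℕtoℚ 2 * G 0 - G 1 - G (N ∸ 1)
    sumUpTo-*-sum±cycleCoeff G = begin
      sumUpTo N (λ u → G u * (c u + c (N ∸ u)))
        ≡⟨ sumUpTo-cong N (λ u _ → *-distribˡ-+ (G u) (c u) (c (N ∸ u))) ⟩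
      sumUpTo N (λ u → G u * c u + G u * c (N ∸ u))
        ≡⟨ sumUpTo-distrib-+ N _ _ ⟩
      sumUpTo N (λ u → G u * c u) + sumUpTo N (λ u → G u * c (N ∸ u))
        ≡⟨ cong₂ _+_ (sumUpTo-truncate {2} {N} (s≤s (s≤s z≤n)) (λ u → G u * c u) (λ u → G*c-vanishing u)) reflected ⟩
      ((0ℚ + G 0 * ℕtoℚ 2) + G 1 * - 1ℚ) + (0ℚ + G (N ∸ 1) * - 1ℚ)
        ≡⟨ collect (G 0) (G 1) (G (N ∸ 1)) ⟩
      ℕtoℚ 2 * G 0 - G 1 - G (N ∸ 1) ∎
      where
      open ≡-Reasoning
      c = cycleCoeff
      G*c-vanishing : ∀ x {y} → 2 ℕ.≤ y → G x * c y ≡ 0ℚ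
      G*c-vanishing x {y} 2≤y = trans (cong (G x *_) (cycleCoeff-vanishing y 2≤y)) (*-zeroʳ (G x))
      H : ℕ → ℚ
      H t = G (N ∸ t) * c t
      reflected : sumUpTo N (λ u → G u * c (N ∸ u)) ≡ 0ℚ + G (N ∸ 1) * - 1ℚ
      reflected = begin
        sumUpTo N (λ u → G u * c (N ∸ u))
          ≡⟨ sumUpTo-cong N (λ u u<N → cong (λ z → G z * c (N ∸ u)) (sym (ℕₚ.m∸[m∸n]≡n (ℕₚ.<⇒≤ u<N)))) ⟩
        sumUpTo N (λ u → H (N ∸ u))
          ≡⟨ sumUpTo-reverse N H ⟩
        sumUpTo N (λ v → H (suc v))
          ≡⟨ sumUpTo-truncate {1} {N} (s≤s z≤n) (λ v → H (suc v)) (λ v 1≤v → G*c-vanishing (N ∸ suc v) (s≤s 1≤v)) ⟩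
        0ℚ + G (N ∸ 1) * - 1ℚ ∎
      collect : ∀ a b e → ((0ℚ + a * (1ℚ + 1ℚ)) + b * - 1ℚ) + (0ℚ + e * - 1ℚ) ≡ (1ℚ + 1ℚ) * a - b - e
      collect = solve-∀ ℚ-ring

    cycleSecondDifference : (ℕ → ℚ) → ℕ → ℕ → ℚ
    cycleSecondDifference f a b = ℕtoℚ 2 * f (dist a b) - f (dist a (b ⊕ 1)) - f (dist a (b ⊕ (N ∸ 1)))

    symCirc-⊗-laplacianCycle : ∀ (f : ℕ → ℚ) (m k : Fin N) →
      (symCirc N f ⊗ laplacianCycle N) m k ≡ cycleSecondDifference f (toℕ m) (toℕ k)
    symCirc-⊗-laplacianCycle f m k = begin
      sumFin N (λ j → f (dist a (toℕ j)) * c (dist (toℕ j) b))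
        ≡⟨ sumFin-toℕ N (λ j → f (dist a j) * c (dist j b)) ⟩
      sumUpTo N (λ j → f (dist a j) * c (dist j b))
        ≡⟨ sym (sumUpTo-⊕ (ℕₚ.<⇒≤ b<N) (λ j → f (dist a j) * c (dist j b))) ⟩
      sumUpTo N (λ u → f (dist a (u ⊕ b)) * c (dist (u ⊕ b) b))
        ≡⟨ sumUpTo-cong N (λ u u<N → cong₂ _*_ (cong (λ z → f (dist a z)) (⊕-comm u b)) (c-shift u<N)) ⟩
      sumUpTo N (λ u → G u * sum± c u)
        ≡⟨ sumUpTo-*-sum±cycleCoeff G ⟩
      ℕtoℚ 2 * G 0 - G 1 - G (N ∸ 1)
        ≡⟨ cong (λ z → ℕtoℚ 2 * f (dist a z) - G 1 - G (N ∸ 1)) (⊕-identityʳ b<N) ⟩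
      ℕtoℚ 2 * f (dist a b) - G 1 - G (N ∸ 1) ∎
      where
      open ≡-Reasoning
      a = toℕ m
      b = toℕ k
      b<N = Finₚ.toℕ<n k
      c = cycleCoeff
      G : ℕ → ℚ
      G u = f (dist a (b ⊕ u))
      c-shift : ∀ {u} → u ℕ.< N → c (dist (u ⊕ b) b) ≡ sum± c u
      c-shift {u} u<N = begin
        c (dist (u ⊕ b) b)    ≡⟨ cong c (trans (dist-comm (u ⊕ b) b) (cong (dist b) (⊕-comm u b))) ⟩
        c (dist b (b ⊕ u))    ≡⟨ cong c (dist-⊕ b<N u<N) ⟩
        c (dist₀ u)           ≡⟨ halfSupported⇒f∘dist₀≡sum± cycleCoeff-halfSupported (ℕₚ.<⇒≤ u<N) ⟩
        sum± c u              ∎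

  module Factorisation (n M : ℕ) (d : ℕ → ℚ) (2M<N : M ℕ.+ M ℕ.< suc (suc (suc n)))
                       (d-vanishing : ∀ t → M ℕ.< t → d t ≡ 0ℚ) (d0≡0 : d 0 ≡ 0ℚ) where

    open CycleProduct n
    open Cyclic N
    open Coefficients M d

    p : ℕ → ℚ
    p = pCoeff M d

    p̂-halfSupported : HalfSupported p̂
    p̂-halfSupported = vanishing⇒halfSupported p̂ (ℕₚ.m≤n⇒m≤1+n (ℕₚ.<⇒≤ 2M<N)) p̂-vanishing

    d-halfSupported : HalfSupported d
    d-halfSupported = vanishing⇒halfSupported d 2[1+M]≤1+N d-vanishing
      where
      2[1+M]≤1+N : suc M ℕ.+ suc M ℕ.≤ suc N
      2[1+M]≤1+N = subst (ℕ._≤ suc N) (cong suc (sym (ℕₚ.+-suc M M))) (s≤s 2M<N)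

    p∘dist₀≡sum±p̂ : ∀ {u} → u ℕ.≤ N → p (dist₀ u) ≡ sum± p̂ u
    p∘dist₀≡sum±p̂ {u} u≤N = trans (pCoeff≡p̂ (dist₀ u)) (halfSupported⇒f∘dist₀≡sum± p̂-halfSupported u≤N)

    cycleSecondDifference-p-diagonal : ∀ {a} → a ℕ.< N → cycleSecondDifference p a a ≡ degree M d * 1ℚ - d (dist a a)
    cycleSecondDifference-p-diagonal {a} a<N = begin
      ℕtoℚ 2 * p (dist a a) - p (dist a (a ⊕ 1)) - p (dist a (a ⊕ (N ∸ 1)))
        ≡⟨ cong₂ (λ x y → ℕtoℚ 2 * p x - p y - p (dist a (a ⊕ (N ∸ 1)))) dist-a-a dist-a-a⊕1 ⟩
      ℕtoℚ 2 * p 0 - p 1 - p (dist a (a ⊕ (N ∸ 1)))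
        ≡⟨ cong (λ y → ℕtoℚ 2 * p 0 - p 1 - p y) dist-a-a⊕N-1 ⟩
      ℕtoℚ 2 * p̂ 0 - p 1 - p 1
        ≡⟨ cong (λ y → ℕtoℚ 2 * p̂ 0 - y - y) (pCoeff≡p̂ 1) ⟩
      ℕtoℚ 2 * p̂ 0 - p̂ 1 - p̂ 1
        ≡⟨ regroup (p̂ 0) (p̂ 1) (d 0) ⟩
      ℕtoℚ 2 * Δ p̂ 0 * 1ℚ - d 0 * 0ℚ
        ≡⟨ cong₂ (λ x y → x * 1ℚ - y) (sym degree≡2Δp̂) (trans (cong (_* 0ℚ) d0≡0) (*-zeroʳ 0ℚ)) ⟩
      degree M d * 1ℚ - 0ℚ
        ≡⟨ cong (λ y → degree M d * 1ℚ - y) (sym (trans (cong d dist-a-a) d0≡0)) ⟩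
      degree M d * 1ℚ - d (dist a a) ∎
      where
      open ≡-Reasoning
      dist-a-a : dist a a ≡ 0
      dist-a-a = cong dist₀ (ℕₚ.∣n-n∣≡0 a)
      dist-a-a⊕1 : dist a (a ⊕ 1) ≡ 1
      dist-a-a⊕1 = dist-⊕ a<N (s≤s (s≤s z≤n))
      dist-a-a⊕N-1 : dist a (a ⊕ (N ∸ 1)) ≡ 1
      dist-a-a⊕N-1 = trans (dist-⊕ a<N (ℕₚ.n<1+n (N ∸ 1))) (dist₀-N∸u (s≤s z≤n))
      regroup : ∀ x y z → (1ℚ + 1ℚ) * x - y - y ≡ (1ℚ + 1ℚ) * (x - y) * 1ℚ - z * 0ℚ
      regroup = solve-∀ ℚ-ring

    cycleSecondDifference-p-offDiagonal : ∀ {a b r} → a ℕ.< N → suc r ℕ.< N → b ≡ a ⊕ suc r →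
                                          cycleSecondDifference p a b ≡ - d (dist a b)
    cycleSecondDifference-p-offDiagonal {a} {_} {r} a<N 1+r<N refl = begin
      ℕtoℚ 2 * p (dist a b) - p (dist a (b ⊕ 1)) - p (dist a (b ⊕ (N ∸ 1)))
        ≡⟨ cong₂ (λ x y → ℕtoℚ 2 * p x - p y - p (dist a (b ⊕ (N ∸ 1)))) dist-a-b dist-a-b⊕1 ⟩
      ℕtoℚ 2 * p (dist₀ s) - p (dist₀ (suc s)) - p (dist a (b ⊕ (N ∸ 1)))
        ≡⟨ cong (λ y → ℕtoℚ 2 * p (dist₀ s) - p (dist₀ (suc s)) - p y) dist-a-b⊕N-1 ⟩
      ℕtoℚ 2 * p (dist₀ s) - p (dist₀ (suc s)) - p (dist₀ r)
        ≡⟨ cong₂ (λ x y → ℕtoℚ 2 * x - y - p (dist₀ r)) (p∘dist₀≡sum±p̂ (ℕₚ.<⇒≤ 1+r<N)) (p∘dist₀≡sum±p̂ 1+r<N) ⟩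
      ℕtoℚ 2 * sum± p̂ s - sum± p̂ (suc s) - p (dist₀ r)
        ≡⟨ cong (λ y → ℕtoℚ 2 * sum± p̂ s - sum± p̂ (suc s) - y) (p∘dist₀≡sum±p̂ (ℕₚ.<⇒≤ r<N)) ⟩
      ℕtoℚ 2 * sum± p̂ s - sum± p̂ (suc s) - sum± p̂ r
        ≡⟨ sum±-second-difference p̂ 1+r<N ⟩
      - (Δ² p̂ r + Δ² p̂ (N ∸ suc s))
        ≡⟨ cong₂ (λ x y → - (x + y)) (Δ²p̂ d-vanishing r) (Δ²p̂ d-vanishing (N ∸ suc s)) ⟩
      - (d s + d (suc (N ∸ suc s)))
        ≡⟨ cong (λ y → - (d s + d y)) (sym (N∸r≡1+[N∸1+r] 1+r<N)) ⟩
      - sum± d s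
        ≡⟨ cong -_ (sym (halfSupported⇒f∘dist₀≡sum± d-halfSupported (ℕₚ.<⇒≤ 1+r<N))) ⟩
      - d (dist₀ s)
        ≡⟨ cong (λ x → - d x) (sym dist-a-b) ⟩
      - d (dist a b) ∎
      where
      open ≡-Reasoning
      s = suc r
      b = a ⊕ s
      r<N : r ℕ.< N
      r<N = ℕₚ.<-trans (ℕₚ.n<1+n r) 1+r<N
      dist-a-b : dist a b ≡ dist₀ s
      dist-a-b = dist-⊕ a<N 1+r<N
      dist-a-b⊕1 : dist a (b ⊕ 1) ≡ dist₀ (suc s)
      dist-a-b⊕1 = trans (cong (dist a) (⊕-assoc a s 1)) (trans (dist-⊕ a<N (⊕<N s 1)) (dist₀-⊕1 1+r<N))
      dist-a-b⊕N-1 : dist a (b ⊕ (N ∸ 1)) ≡ dist₀ r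
      dist-a-b⊕N-1 = trans (cong (dist a) (trans (⊕-assoc a s (N ∸ 1)) (cong (a ⊕_) (suc⊕N∸1 r<N)))) (dist-⊕ a<N r<N)

    laplacian≡P⊗laplacianCycle : ∀ m k → laplacian N M d m k ≡ (P-GS N M d ⊗ laplacianCycle N) m k
    -- Deciding m ≟ k also evaluates identity m k in the goal.
    laplacian≡P⊗laplacianCycle m k with m Fin.≟ k
    ... | yes refl = begin
      degree M d * 1ℚ - d (dist a a)        ≡⟨ sym (cycleSecondDifference-p-diagonal a<N) ⟩
      cycleSecondDifference p a a           ≡⟨ sym (symCirc-⊗-laplacianCycle p m m) ⟩
      (P-GS N M d ⊗ laplacianCycle N) m m   ∎
      where
      open ≡-Reasoning
      a = toℕ m
      a<N = Finₚ.toℕ<n m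
    ... | no m≢k with ⊕-surjective (Finₚ.toℕ<n m) (Finₚ.toℕ<n k)
    ...   | zero  , _     , b≡a⊕0   =
      ⊥-elim (m≢k (Finₚ.toℕ-injective (sym (trans b≡a⊕0 (⊕-identityʳ (Finₚ.toℕ<n m))))))
    ...   | suc r , 1+r<N , b≡a⊕1+r = begin
      degree M d * 0ℚ - d (dist a b)        ≡⟨ annihilate (degree M d) (d (dist a b)) ⟩
      - d (dist a b)                        ≡⟨ sym (cycleSecondDifference-p-offDiagonal a<N 1+r<N b≡a⊕1+r) ⟩
      cycleSecondDifference p a b           ≡⟨ sym (symCirc-⊗-laplacianCycle p m k) ⟩
      (P-GS N M d ⊗ laplacianCycle N) m k   ∎
      where
      open ≡-Reasoning
      a = toℕ m
      b = toℕ k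
      a<N = Finₚ.toℕ<n m
      annihilate : ∀ x y → x * 0ℚ - y ≡ - y
      annihilate = solve-∀ ℚ-ring

  ramp-suc : ∀ {k u} → u ℕ.≤ k → ramp (suc k) u ≡ 1ℚ + ramp k u
  ramp-suc {k} {u} u≤k = trans (cong ℕtoℚ (ℕₚ.+-∸-assoc 1 u≤k)) (ℕtoℚ-suc (k ∸ u))

  sumUpTo²-∣-∣ : ∀ k (h : ℕ → ℚ) →
    sumUpTo k (λ i → sumUpTo k (λ i′ → h ∣ i - i′ ∣)) ≡
    sumUpTo k (λ u → ramp k u * h u) + sumUpTo k (λ v → ramp k (suc v) * h (suc v))
  sumUpTo²-∣-∣ zero    h = refl
  sumUpTo²-∣-∣ (suc k) h = begin
    sumUpTo (suc k) (λ i → sumUpTo k (λ i′ → h ∣ i - i′ ∣) + h ∣ i - k ∣)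
      ≡⟨ sumUpTo-distrib-+ (suc k) _ _ ⟩
    (D + sumUpTo k (λ i′ → h ∣ k - i′ ∣)) + (sumUpTo k (λ i → h ∣ i - k ∣) + h ∣ k - k ∣)
      ≡⟨ cong₂ _+_ (cong₂ _+_ (sumUpTo²-∣-∣ k h) last-row) (cong₂ _+_ last-column (cong h (ℕₚ.∣n-n∣≡0 k))) ⟩
    ((A + B) + S₁) + (S₁ + h 0)
      ≡⟨ shuffle₁ A B S₁ (h 0) ⟩
    (h 0 + S₁) + A + (S₁ + B)
      ≡⟨ cong (λ z → z + A + (S₁ + B)) (sym (sumUpTo-suc-head k h)) ⟩
    (S₀ + h k) + A + (S₁ + B)
      ≡⟨ sym (cong₂ _+_ unshifted shifted) ⟩
    sumUpTo (suc k) (λ u → ramp (suc k) u * h u) + sumUpTo (suc k) (λ v → ramp (suc k) (suc v) * h (suc v)) ∎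
    where
    open ≡-Reasoning
    D = sumUpTo k (λ i → sumUpTo k (λ i′ → h ∣ i - i′ ∣))
    A = sumUpTo k (λ u → ramp k u * h u)
    B = sumUpTo k (λ v → ramp k (suc v) * h (suc v))
    S₀ = sumUpTo k h
    S₁ = sumUpTo k (λ v → h (suc v))
    last-row : sumUpTo k (λ i′ → h ∣ k - i′ ∣) ≡ S₁
    last-row = trans (sumUpTo-cong k (λ i′ i′<k → cong h (ℕₚ.m≤n⇒∣n-m∣≡n∸m (ℕₚ.<⇒≤ i′<k)))) (sumUpTo-reverse k h)
    last-column : sumUpTo k (λ i → h ∣ i - k ∣) ≡ S₁
    last-column = trans (sumUpTo-cong k (λ i i<k → cong h (ℕₚ.m≤n⇒∣m-n∣≡n∸m (ℕₚ.<⇒≤ i<k)))) (sumUpTo-reverse k h)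
    shuffle₁ : ∀ A B S₁ h₀ → ((A + B) + S₁) + (S₁ + h₀) ≡ (h₀ + S₁) + A + (S₁ + B)
    shuffle₁ = solve-∀ ℚ-ring
    ramp-k-k* : ∀ x → ramp k k * x ≡ 0ℚ
    ramp-k-k* x = trans (cong (_* x) (ramp-vanishing {k} ℕₚ.≤-refl)) (*-zeroˡ x)
    peel-ramp : ∀ {u} → u ℕ.≤ k → ramp (suc k) u * h u ≡ h u + ramp k u * h u
    peel-ramp {u} u≤k = begin
      ramp (suc k) u * h u           ≡⟨ cong (_* h u) (ramp-suc u≤k) ⟩
      (1ℚ + ramp k u) * h u          ≡⟨ *-distribʳ-+ (h u) 1ℚ (ramp k u) ⟩
      1ℚ * h u + ramp k u * h u      ≡⟨ cong (_+ ramp k u * h u) (*-identityˡ (h u)) ⟩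
      h u + ramp k u * h u           ∎
    unshifted : sumUpTo (suc k) (λ u → ramp (suc k) u * h u) ≡ (S₀ + h k) + A
    unshifted = begin
      sumUpTo k (λ u → ramp (suc k) u * h u) + ramp (suc k) k * h k
        ≡⟨ cong₂ _+_ (sumUpTo-cong k (λ u u<k → peel-ramp (ℕₚ.<⇒≤ u<k))) (peel-ramp ℕₚ.≤-refl) ⟩
      sumUpTo k (λ u → h u + ramp k u * h u) + (h k + ramp k k * h k)
        ≡⟨ cong₂ _+_ (sumUpTo-distrib-+ k _ _) (cong (h k +_) (ramp-k-k* (h k))) ⟩
      (S₀ + A) + (h k + 0ℚ)
        ≡⟨ shuffle₂ S₀ A (h k) ⟩
      (S₀ + h k) + A ∎
      where
      shuffle₂ : ∀ a b c → (a + b) + (c + 0ℚ) ≡ (a + c) + b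
      shuffle₂ = solve-∀ ℚ-ring
    shifted : sumUpTo (suc k) (λ v → ramp (suc k) (suc v) * h (suc v)) ≡ S₁ + B
    shifted = begin
      sumUpTo k (λ v → ramp (suc k) (suc v) * h (suc v)) + ramp k k * h (suc k)
        ≡⟨ cong₂ _+_ (sumUpTo-cong k (λ v v<k → peel-ramp v<k)) (ramp-k-k* (h (suc k))) ⟩
      sumUpTo k (λ v → h (suc v) + ramp k (suc v) * h (suc v)) + 0ℚ
        ≡⟨ trans (+-identityʳ _) (sumUpTo-distrib-+ k _ _) ⟩
      S₁ + B ∎

  module QuadraticForm (N : ℕ) .{{_ : NonZero N}} (X : ℕ → ℚ) where

    open Cyclic N

    autocorrelation : ℕ → ℚ
    autocorrelation u = sumUpTo N (λ a → X a * X (a ⊕ u))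

    R : ℕ → ℚ
    R = autocorrelation

    autocorrelation-N∸u : ∀ {u} → u ℕ.≤ N → R (N ∸ u) ≡ R u
    autocorrelation-N∸u {u} u≤N = begin
      sumUpTo N (λ a → X a * X (a ⊕ (N ∸ u)))
        ≡⟨ sym (sumUpTo-⊕ u≤N (λ a → X a * X (a ⊕ (N ∸ u)))) ⟩
      sumUpTo N (λ a → X (a ⊕ u) * X (a ⊕ u ⊕ (N ∸ u)))
        ≡⟨ sumUpTo-cong N (λ a a<N → trans (cong (λ z → X (a ⊕ u) * X z) (undo a<N)) (*-comm _ (X a))) ⟩
      sumUpTo N (λ a → X a * X (a ⊕ u)) ∎
      where
      open ≡-Reasoning
      undo : ∀ {a} → a ℕ.< N → a ⊕ u ⊕ (N ∸ u) ≡ a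
      undo {a} a<N = trans (⊕-assoc a u (N ∸ u)) (trans (cong (a ⊕_) (⊕-inverseʳ u≤N)) (⊕-identityʳ a<N))

    sumUpTo-shifted-products-≤ : ∀ {i i′} → i ℕ.≤ i′ → i′ ℕ.< N →
                                 sumUpTo N (λ c → X (c ⊕ i) * X (c ⊕ i′)) ≡ R (i′ ∸ i)
    sumUpTo-shifted-products-≤ {i} {i′} i≤i′ i′<N = begin
      sumUpTo N (λ c → X (c ⊕ i) * X (c ⊕ i′))
        ≡⟨ sumUpTo-cong N (λ c _ → cong (λ z → X (c ⊕ i) * X z) (sym (c⊕i⊕t≡c⊕i′ c))) ⟩
      sumUpTo N (λ c → X (c ⊕ i) * X (c ⊕ i ⊕ t))
        ≡⟨ sumUpTo-⊕ (ℕₚ.≤-trans i≤i′ (ℕₚ.<⇒≤ i′<N)) (λ c → X c * X (c ⊕ t)) ⟩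
      R t ∎
      where
      open ≡-Reasoning
      t = i′ ∸ i
      i⊕t≡i′ : i ⊕ t ≡ i′
      i⊕t≡i′ = trans (+<N⇒⊕≡+ i t (subst (ℕ._< N) (sym (ℕₚ.m+[n∸m]≡n i≤i′)) i′<N)) (ℕₚ.m+[n∸m]≡n i≤i′)
      c⊕i⊕t≡c⊕i′ : ∀ c → c ⊕ i ⊕ t ≡ c ⊕ i′
      c⊕i⊕t≡c⊕i′ c = trans (⊕-assoc c i t) (cong (c ⊕_) i⊕t≡i′)

    sumUpTo-shifted-products : ∀ {i i′} → i ℕ.< N → i′ ℕ.< N →
                               sumUpTo N (λ c → X (c ⊕ i) * X (c ⊕ i′)) ≡ R ∣ i - i′ ∣
    sumUpTo-shifted-products {i} {i′} i<N i′<N with i ℕ.≤? i′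
    ... | yes i≤i′ = trans (sumUpTo-shifted-products-≤ i≤i′ i′<N) (cong R (sym (ℕₚ.m≤n⇒∣m-n∣≡n∸m i≤i′)))
    ... | no i≰i′ = begin
      sumUpTo N (λ c → X (c ⊕ i) * X (c ⊕ i′))    ≡⟨ sumUpTo-cong N (λ c _ → *-comm (X (c ⊕ i)) (X (c ⊕ i′))) ⟩
      sumUpTo N (λ c → X (c ⊕ i′) * X (c ⊕ i))    ≡⟨ sumUpTo-shifted-products-≤ i′≤i i<N ⟩
      R (i ∸ i′)                                    ≡⟨ cong R (sym (ℕₚ.m≤n⇒∣n-m∣≡n∸m i′≤i)) ⟩
      R ∣ i - i′ ∣                                  ∎
      where
      open ≡-Reasoning
      i′≤i : i′ ℕ.≤ i
      i′≤i = ℕₚ.<⇒≤ (ℕₚ.≰⇒> i≰i′)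

    quadForm : (ℕ → ℚ) → ℚ
    quadForm f = sumUpTo N (λ a → sumUpTo N (λ b → X a * f (dist a b) * X b))

    quadForm-cong : ∀ {f g} → (∀ t → f t ≡ g t) → quadForm f ≡ quadForm g
    quadForm-cong f≗g =
      sumUpTo-cong N (λ a _ → sumUpTo-cong N (λ b _ → cong (λ z → X a * z * X b) (f≗g (dist a b))))

    quadForm-sumUpTo : ∀ n (g : ℕ → ℕ → ℚ) (w : ℕ → ℚ) →
                       quadForm (λ t → sumUpTo n (λ j → g j t * w j)) ≡ sumUpTo n (λ j → quadForm (g j) * w j)
    quadForm-sumUpTo n g w = begin
      sumUpTo N (λ a → sumUpTo N (λ b → X a * sumUpTo n (λ j → g j (dist a b) * w j) * X b))
        ≡⟨ sumUpTo-cong N (λ a _ → sumUpTo-cong N (λ b _ → pull-out a b)) ⟩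
      sumUpTo N (λ a → sumUpTo N (λ b → sumUpTo n (λ j → term j a b * w j)))
        ≡⟨ sumUpTo-cong N (λ a _ → sumUpTo-comm N n _) ⟩
      sumUpTo N (λ a → sumUpTo n (λ j → sumUpTo N (λ b → term j a b * w j)))
        ≡⟨ sumUpTo-comm N n _ ⟩
      sumUpTo n (λ j → sumUpTo N (λ a → sumUpTo N (λ b → term j a b * w j)))
        ≡⟨ sumUpTo-cong n (λ j _ → sym (pull-in j)) ⟩
      sumUpTo n (λ j → quadForm (g j) * w j) ∎
      where
      open ≡-Reasoning
      term : ℕ → ℕ → ℕ → ℚ
      term j a b = X a * g j (dist a b) * X b
      pull-out : ∀ a b → X a * sumUpTo n (λ j → g j (dist a b) * w j) * X b ≡ sumUpTo n (λ j → term j a b * w j)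
      pull-out a b = begin
        X a * sumUpTo n (λ j → g j (dist a b) * w j) * X b
          ≡⟨ cong (_* X b) (*-distribˡ-sumUpTo n (X a) _) ⟩
        sumUpTo n (λ j → X a * (g j (dist a b) * w j)) * X b
          ≡⟨ *-distribʳ-sumUpTo n (X b) _ ⟩
        sumUpTo n (λ j → X a * (g j (dist a b) * w j) * X b)
          ≡⟨ sumUpTo-cong n (λ j _ → reassociate (X a) (g j (dist a b)) (w j) (X b)) ⟩
        sumUpTo n (λ j → term j a b * w j) ∎
        where
        reassociate : ∀ x y z u → x * (y * z) * u ≡ x * y * u * z
        reassociate = solve-∀ ℚ-ring
      pull-in : ∀ j → quadForm (g j) * w j ≡ sumUpTo N (λ a → sumUpTo N (λ b → term j a b * w j))
      pull-in j = trans (*-distribʳ-sumUpTo N (w j) _) (sumUpTo-cong N (λ a _ → *-distribʳ-sumUpTo N (w j) _))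

    quadForm≡sumUpTo-autocorrelation : ∀ f → quadForm f ≡ sumUpTo N (λ u → f (dist₀ u) * R u)
    quadForm≡sumUpTo-autocorrelation f = begin
      sumUpTo N (λ a → sumUpTo N (λ b → X a * f (dist a b) * X b))
        ≡⟨ sumUpTo-cong N (λ a a<N → sym (sumUpTo-⊕ (ℕₚ.<⇒≤ a<N) (λ b → X a * f (dist a b) * X b))) ⟩
      sumUpTo N (λ a → sumUpTo N (λ u → X a * f (dist a (u ⊕ a)) * X (u ⊕ a)))
        ≡⟨ sumUpTo-cong N (λ a a<N → sumUpTo-cong N (λ u u<N → shift a<N u<N)) ⟩
      sumUpTo N (λ a → sumUpTo N (λ u → f (dist₀ u) * (X a * X (a ⊕ u))))
        ≡⟨ sumUpTo-comm N N _ ⟩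
      sumUpTo N (λ u → sumUpTo N (λ a → f (dist₀ u) * (X a * X (a ⊕ u))))
        ≡⟨ sumUpTo-cong N (λ u _ → sym (*-distribˡ-sumUpTo N (f (dist₀ u)) _)) ⟩
      sumUpTo N (λ u → f (dist₀ u) * R u) ∎
      where
      open ≡-Reasoning
      reorder : ∀ x y z → x * y * z ≡ y * (x * z)
      reorder = solve-∀ ℚ-ring
      shift : ∀ {a u} → a ℕ.< N → u ℕ.< N →
              X a * f (dist a (u ⊕ a)) * X (u ⊕ a) ≡ f (dist₀ u) * (X a * X (a ⊕ u))
      shift {a} {u} a<N u<N = begin
        X a * f (dist a (u ⊕ a)) * X (u ⊕ a)   ≡⟨ cong (λ z → X a * f (dist a z) * X z) (⊕-comm u a) ⟩
        X a * f (dist a (a ⊕ u)) * X (a ⊕ u)   ≡⟨ cong (λ z → X a * f z * X (a ⊕ u)) (dist-⊕ a<N u<N) ⟩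
        X a * f (dist₀ u) * X (a ⊕ u)          ≡⟨ reorder (X a) (f (dist₀ u)) (X (a ⊕ u)) ⟩
        f (dist₀ u) * (X a * X (a ⊕ u))        ∎

    quadForm-halfSupported : ∀ {f} → HalfSupported f →
      quadForm f ≡ sumUpTo N (λ u → f u * R u) + sumUpTo N (λ v → f (suc v) * R (suc v))
    quadForm-halfSupported {f} f-half = begin
      quadForm f
        ≡⟨ quadForm≡sumUpTo-autocorrelation f ⟩
      sumUpTo N (λ u → f (dist₀ u) * R u)
        ≡⟨ sumUpTo-cong N (λ u u<N → trans (cong (_* R u) (halfSupported⇒f∘dist₀≡sum± f-half (ℕₚ.<⇒≤ u<N)))
                                           (*-distribʳ-+ (R u) (f u) (f (N ∸ u)))) ⟩
      sumUpTo N (λ u → f u * R u + f (N ∸ u) * R u)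
        ≡⟨ sumUpTo-distrib-+ N _ _ ⟩
      sumUpTo N (λ u → f u * R u) + sumUpTo N (λ u → f (N ∸ u) * R u)
        ≡⟨ cong (sumUpTo N (λ u → f u * R u) +_) reflected ⟩
      sumUpTo N (λ u → f u * R u) + sumUpTo N (λ v → f (suc v) * R (suc v)) ∎
      where
      open ≡-Reasoning
      reflected : sumUpTo N (λ u → f (N ∸ u) * R u) ≡ sumUpTo N (λ v → f (suc v) * R (suc v))
      reflected = trans (sumUpTo-cong N (λ u u<N → cong (f (N ∸ u) *_) (sym (autocorrelation-N∸u (ℕₚ.<⇒≤ u<N)))))
                        (sumUpTo-reverse N (λ t → f t * R t))

    windowSum : ℕ → ℕ → ℚ
    windowSum k c = sumUpTo k (λ i → X (c ⊕ i))

    sumUpTo-windowSum² : ∀ {k} → k ℕ.≤ N →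
      sumUpTo N (λ c → windowSum k c * windowSum k c) ≡ sumUpTo k (λ i → sumUpTo k (λ i′ → R ∣ i - i′ ∣))
    sumUpTo-windowSum² {k} k≤N = begin
      sumUpTo N (λ c → windowSum k c * windowSum k c)
        ≡⟨ sumUpTo-cong N (λ c _ → trans (*-distribʳ-sumUpTo k (windowSum k c) _)
                                         (sumUpTo-cong k (λ i _ → *-distribˡ-sumUpTo k (X (c ⊕ i)) _))) ⟩
      sumUpTo N (λ c → sumUpTo k (λ i → sumUpTo k (λ i′ → X (c ⊕ i) * X (c ⊕ i′))))
        ≡⟨ sumUpTo-comm N k _ ⟩
      sumUpTo k (λ i → sumUpTo N (λ c → sumUpTo k (λ i′ → X (c ⊕ i) * X (c ⊕ i′))))
        ≡⟨ sumUpTo-cong k (λ i i<k → trans (sumUpTo-comm N k _) (sumUpTo-cong k (λ i′ i′<k →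
             sumUpTo-shifted-products (ℕₚ.<-≤-trans i<k k≤N) (ℕₚ.<-≤-trans i′<k k≤N)))) ⟩
      sumUpTo k (λ i → sumUpTo k (λ i′ → R ∣ i - i′ ∣)) ∎
      where open ≡-Reasoning

    quadForm-ramp : ∀ {k} → k ℕ.+ k ℕ.< N → quadForm (ramp k) ≡ sumUpTo N (λ c → windowSum k c * windowSum k c)
    quadForm-ramp {k} 2k<N = begin
      quadForm (ramp k)
        ≡⟨ quadForm-halfSupported (vanishing⇒halfSupported (ramp k) (ℕₚ.m≤n⇒m≤1+n (ℕₚ.<⇒≤ 2k<N)) (λ _ → ramp-vanishing)) ⟩
      sumUpTo N (λ u → ramp k u * R u) + sumUpTo N (λ v → ramp k (suc v) * R (suc v))
        ≡⟨ cong₂ _+_ (sumUpTo-truncate k≤N _ (λ u k≤u → ramp*R-vanishing k≤u))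
                     (sumUpTo-truncate k≤N _ (λ v k≤v → ramp*R-vanishing (ℕₚ.m≤n⇒m≤1+n k≤v))) ⟩
      sumUpTo k (λ u → ramp k u * R u) + sumUpTo k (λ v → ramp k (suc v) * R (suc v))
        ≡⟨ sym (sumUpTo²-∣-∣ k R) ⟩
      sumUpTo k (λ i → sumUpTo k (λ i′ → R ∣ i - i′ ∣))
        ≡⟨ sym (sumUpTo-windowSum² k≤N) ⟩
      sumUpTo N (λ c → windowSum k c * windowSum k c) ∎
      where
      open ≡-Reasoning
      k≤N : k ℕ.≤ N
      k≤N = ℕₚ.≤-trans (ℕₚ.m≤m+n k k) (ℕₚ.<⇒≤ 2k<N)
      ramp*R-vanishing : ∀ {u} → k ℕ.≤ u → ramp k u * R u ≡ 0ℚ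
      ramp*R-vanishing {u} k≤u = trans (cong (_* R u) (ramp-vanishing k≤u)) (*-zeroˡ (R u))

  extend : ∀ {N} → (Fin N → ℚ) → ℕ → ℚ
  extend {N} x j with j ℕ.<? N
  ... | yes j<N = x (fromℕ< j<N)
  ... | no _    = 0ℚ

  extend-toℕ : ∀ {N} (x : Fin N → ℚ) m → extend x (toℕ m) ≡ x m
  extend-toℕ {N} x m with toℕ m ℕ.<? N
  ... | yes m<N = cong x (Finₚ.fromℕ<-toℕ m m<N)
  ... | no m≮N  = ⊥-elim (m≮N (Finₚ.toℕ<n m))

  module Positivity (N M : ℕ) .{{_ : NonZero N}} (d : ℕ → ℚ) (2M<N : M ℕ.+ M ℕ.< N)
                    (d≥0 : ∀ i → 0ℚ ≤ d i) (d₁>0 : 0ℚ < d 1) (1≤M : 1 ℕ.≤ M) where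

    open Cyclic N
    open Coefficients M d

    sumFin-symCirc≡quadForm : ∀ f (x : Fin N → ℚ) →
      sumFin N (λ m → sumFin N (λ k → x m * symCirc N f m k * x k)) ≡ QuadraticForm.quadForm N (extend x) f
    sumFin-symCirc≡quadForm f x = begin
      sumFin N (λ m → sumFin N (λ k → x m * f (dist (toℕ m) (toℕ k)) * x k))
        ≡⟨ sumFin-cong N (λ m → sumFin-cong N (λ k →
             sym (cong₂ (λ u v → u * f (dist (toℕ m) (toℕ k)) * v) (extend-toℕ x m) (extend-toℕ x k)))) ⟩
      sumFin N (λ m → sumFin N (λ k → X (toℕ m) * f (dist (toℕ m) (toℕ k)) * X (toℕ k)))
        ≡⟨ sumFin-cong N (λ m → sumFin-toℕ N (λ b → X (toℕ m) * f (dist (toℕ m) b) * X b)) ⟩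
      sumFin N (λ m → sumUpTo N (λ b → X (toℕ m) * f (dist (toℕ m) b) * X b))
        ≡⟨ sumFin-toℕ N (λ a → sumUpTo N (λ b → X a * f (dist a b) * X b)) ⟩
      sumUpTo N (λ a → sumUpTo N (λ b → X a * f (dist a b) * X b)) ∎
      where
      open ≡-Reasoning
      X = extend x

    P-GS-positiveDefinite : PositiveDefinite (P-GS N M d)
    P-GS-positiveDefinite x (i , xᵢ≢0) = subst (0ℚ <_) (sym expand) sum-pos
      where
      open QuadraticForm N (extend x)
      expand : sumFin N (λ m → sumFin N (λ k → x m * P-GS N M d m k * x k)) ≡
               sumUpTo M (λ j → quadForm (ramp (suc j)) * d (suc j))
      expand = trans (sumFin-symCirc≡quadForm (pCoeff M d) x)
                     (trans (quadForm-cong pCoeff≡p̂) (quadForm-sumUpTo M (λ j → ramp (suc j)) (λ j → d (suc j))))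
      window-nonneg : ∀ {k} → k ℕ.+ k ℕ.< N → 0ℚ ≤ quadForm (ramp k)
      window-nonneg {k} 2k<N =
        subst (0ℚ ≤_) (sym (quadForm-ramp 2k<N)) (sumUpTo-nonneg N _ (λ c _ → square-nonneg (windowSum k c)))
      window₁-pos : 0ℚ < quadForm (ramp 1)
      window₁-pos = subst (0ℚ <_) (sym (quadForm-ramp (ℕₚ.≤-<-trans (ℕₚ.+-mono-≤ 1≤M 1≤M) 2M<N)))
                      (sumUpTo-pos N _ (λ c _ → square-nonneg (windowSum 1 c)) (toℕ i) (Finₚ.toℕ<n i)
                        (square-pos (windowSum 1 (toℕ i)) windowSum₁≢0))
        where
        windowSum₁≢0 : windowSum 1 (toℕ i) ≢ 0ℚ
        windowSum₁≢0 w≡0 = xᵢ≢0 (begin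
          x i                        ≡⟨ sym (extend-toℕ x i) ⟩
          extend x (toℕ i)           ≡⟨ cong (extend x) (sym (⊕-identityʳ (Finₚ.toℕ<n i))) ⟩
          extend x (toℕ i ⊕ 0)       ≡⟨ sym (+-identityˡ _) ⟩
          windowSum 1 (toℕ i)        ≡⟨ w≡0 ⟩
          0ℚ                         ∎)
          where open ≡-Reasoning
      sum-pos : 0ℚ < sumUpTo M (λ j → quadForm (ramp (suc j)) * d (suc j))
      sum-pos = sumUpTo-pos M _ (λ j j<M → *-nonneg (window-nonneg (ℕₚ.≤-<-trans (ℕₚ.+-mono-≤ j<M j<M) 2M<N))
                                                      (d≥0 (suc j)))
                            0 1≤M (*-pos window₁-pos d₁>0)

  3≤n⇒n≡3+k : ∀ {n} → 3 ℕ.≤ n → ∃[ k ] n ≡ suc (suc (suc k))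
  3≤n⇒n≡3+k (s≤s (s≤s (s≤s {n = k} _))) = k , refl

  laplacian≡P-GS⊗laplacianCycle : ∀ {N M} (d : ℕ → ℚ) → 1 ℕ.≤ M → M ℕ.+ M ℕ.< N →
    (∀ t → M ℕ.< t → d t ≡ 0ℚ) → d 0 ≡ 0ℚ →
    ∀ m k → laplacian N M d m k ≡ (P-GS N M d ⊗ laplacianCycle N) m k
  laplacian≡P-GS⊗laplacianCycle {N} {M} d 1≤M 2M<N d-vanishing d₀≡0
    with 3≤n⇒n≡3+k (ℕₚ.≤-trans (s≤s (ℕₚ.+-mono-≤ 1≤M 1≤M)) 2M<N)
  ... | n , refl = Factorisation.laplacian≡P⊗laplacianCycle n M d 2M<N d-vanishing d₀≡0

  P-GS-positiveDefinite : ∀ {N M} (d : ℕ → ℚ) → 1 ℕ.≤ M → M ℕ.+ M ℕ.< N →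
    (∀ i → 0ℚ ≤ d i) → 0ℚ < d 1 → PositiveDefinite (P-GS N M d)
  P-GS-positiveDefinite {N} {M} d 1≤M 2M<N d≥0 d₁>0 =
    Positivity.P-GS-positiveDefinite N M {{ℕ.>-nonZero (ℕₚ.≤-<-trans z≤n 2M<N)}} d 2M<N d≥0 d₁>0 1≤M

open CirculantLaplacian using (laplacian≡P-GS⊗laplacianCycle; P-GS-positiveDefinite)

open import Data.Nat using (ℕ; _+_; _≤_; _<_; _*_; _/_)
open import Data.Rational using (ℚ; 0ℚ) renaming (_≤_ to _≤ℚ_; _<_ to _<ℚ_)
open import Data.Product using (_×_; _,_; proj₁)
open import Relation.Nullary using (¬_)
open import Relation.Binary.PropositionalEquality using (_≡_; cong; subst)
import Data.Nat.Properties as ℕₚ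

lemma4p3 : (N M : ℕ) (S : ℕ → Set) (d : ℕ → ℚ) →
    (∀ s → S s → 1 ≤ s × s ≤ N / 2) →
    S 1 →
    S M → (∀ s → S s → s ≤ M) →
    2 * M < N →
    (∀ i → ¬ S i → d i ≡ 0ℚ) →
    (∀ i → 0ℚ ≤ℚ d i) →
    0ℚ <ℚ d 1 →
    (∀ m n → laplacian N M d m n ≡ (P-GS N M d ⊗ laplacianCycle N) m n)
      × PositiveDefinite (P-GS N M d)
lemma4p3 N M S d S⊆[1,N/2] S1 _ S≤M 2*M<N d-off d≥0 d₁>0 =
  laplacian≡P-GS⊗laplacianCycle d 1≤M 2M<N d-vanishing d₀≡0 , P-GS-positiveDefinite d 1≤M 2M<N d≥0 d₁>0
  where
  1≤M : 1 ≤ M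
  1≤M = S≤M 1 S1
  2M<N : M + M < N
  2M<N = subst (_< N) (cong (M +_) (ℕₚ.+-identityʳ M)) 2*M<N
  d-vanishing : ∀ t → M < t → d t ≡ 0ℚ
  d-vanishing t M<t = d-off t (λ St → ℕₚ.<⇒≱ M<t (S≤M t St))
  d₀≡0 : d 0 ≡ 0ℚ
  d₀≡0 = d-off 0 (λ S0 → ℕₚ.n≮0 (proj₁ (S⊆[1,N/2] 0 S0)))
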